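{- For any positive integer $\ell$, \[D(K_{1,\ell,\ell},K^\circlearrowright_3)=\sum_{i=0}^{\ell}\sum_{j=0}^{\ell}\binom{\ell}{i}\binom{\ell}{j}2^{(\ell-i)j+(\ell-j)i}.\]
   Context: $K_{1,\ell,\ell}$ is the complete tripartite graph with parts of sizes $1,\ell,\ell$. For a graph $G$, $D(G,K^\circlearrowright_3)$ is the number of orientations of $G$ containing no cyclically oriented triangle. -}

module Defs where

open import Data.Nat using (ℕ; zero; suc; _+_; _*_; _∸_; _^_; _<ᵇ_; _≡ᵇ_)
open import Data.Nat.Combinatorics using (_C_)
open import Data.Fin using (Fin; zero; suc; toℕ)
open import Data.Bool using (Bool; true; false; _∧_; _∨_; not; _xor_; if_then_else_)
open import Data.List using (List; []; _∷_; map; concatMap; upTo; allFin)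
open import Data.Nat.ListAction using (sum)
open import Data.Bool.ListAction using (all; any)

-- A (finite, simple, loopless) graph on vertex set Fin n, given by a Boolean adjacency relation
-- which is symmetric and irreflexive.
record Graph : Set where
  field
    n   : ℕ
    adj : Fin n → Fin n → Bool

-- A candidate relation "u → v" on the vertices; an orientation of G is such a relation in which
-- every arc is an edge of G and every edge {u,v} receives exactly one of the two directions.
Rel : ℕ → Set
Rel n = Fin n → Fin n → Bool

_⇒ᵇ_ : Bool → Bool → Bool
a ⇒ᵇ b = not a ∨ b

forallV : {n : ℕ} → (Fin n → Bool) → Bool
forallV {n} p = all p (allFin n)

existsV : {n : ℕ} → (Fin n → Bool) → Bool
existsV {n} p = any p (allFin n)

isOrientation : (G : Graph) → Rel (Graph.n G) → Bool
isOrientation G o =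
  forallV λ u → forallV λ v →
    (o u v ⇒ᵇ adj u v) ∧ (adj u v ⇒ᵇ (o u v xor o v u))
  where open Graph G

-- o contains a cyclically oriented triangle u → v → w → u
-- (u, v, w are automatically distinct since arcs are edges of a loopless graph).
hasCyclicTriangle : {n : ℕ} → Rel n → Bool
hasCyclicTriangle o =
  existsV λ u → existsV λ v → existsV λ w → o u v ∧ o v w ∧ o w u

extend : {A : Set} {m : ℕ} → A → (Fin m → A) → Fin (suc m) → A
extend a f zero    = a
extend a f (suc i) = f i

allFuns : {A : Set} → List A → (m : ℕ) → List (Fin m → A)
allFuns xs zero    = (λ ()) ∷ []
allFuns xs (suc m) = concatMap (λ a → map (extend a) (allFuns xs m)) xs

allRels : (n : ℕ) → List (Rel n)
allRels n = allFuns (allFuns (true ∷ false ∷ []) n) n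

countᵇ : {A : Set} → (A → Bool) → List A → ℕ
countᵇ p []       = 0
countᵇ p (x ∷ xs) = (if p x then 1 else 0) + countᵇ p xs

D-cyc : Graph → ℕ
D-cyc G = countᵇ (λ o → isOrientation G o ∧ not (hasCyclicTriangle o)) (allRels (Graph.n G))

-- The complete tripartite graph K_{1,ℓ,ℓ} on Fin (1 + (ℓ + ℓ)):
-- vertex 0 forms the part of size 1, vertices 1..ℓ the second part, ℓ+1..2ℓ the third.
part : (ℓ : ℕ) → Fin (suc (ℓ + ℓ)) → ℕ
part ℓ zero    = 0
part ℓ (suc i) = if toℕ i <ᵇ ℓ then 1 else 2

K1ℓℓ : ℕ → Graph
K1ℓℓ ℓ = record { n = suc (ℓ + ℓ) ; adj = λ u v → not (part ℓ u ≡ᵇ part ℓ v) }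

rhs : ℕ → ℕ
rhs ℓ = sum (map (λ i → sum (map (λ j →
          (ℓ C i) * (ℓ C j) * 2 ^ ((ℓ ∸ i) * j + (ℓ ∸ j) * i)) (upTo (suc ℓ)))) (upTo (suc ℓ)))

module Submission where

-- Call the vertex of the part of size 1 the hub and the other two parts A and B.  Every
-- triangle of K_{1,ℓ,ℓ} consists of the hub, some a ∈ A and some b ∈ B.  An orientation is
-- therefore described by the arcs sA(a) = [hub→a], sB(b) = [hub→b] and the arcs between A and
-- B, and it has no cyclic triangle iff for all a, b the arc between a and b is free when
-- sA(a) = sB(b) and forced otherwise.  So D = Σ_{sA,sB} 2^{#{(a,b) : sA(a) = sB(b)}}, and that
-- number of agreeing pairs is #true sA · #true sB + #false sA · #false sB; counting Boolean
-- vectors by their number of true (false) coordinates gives the binomial double sum.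

open import Defs
open import Data.Nat using (ℕ; zero; suc; _+_; _*_; _∸_; _^_; _≤_; _<_; _<ᵇ_; _≡ᵇ_; z≤n; s≤s)
open import Data.Nat.Properties
open import Data.Nat.Combinatorics using (_C_; nCk+nC[k+1]≡[n+1]C[k+1]; k>n⇒nCk≡0)
open import Data.Nat.ListAction using (sum)
open import Data.Nat.ListAction.Properties using (sum-++)
open import Data.Fin using (Fin; zero; suc; toℕ; _↑ˡ_; _↑ʳ_)
open import Data.Fin.Properties using (toℕ<n; toℕ-↑ˡ; toℕ-↑ʳ)
open import Data.Bool using (Bool; true; false; _∧_; _∨_; not; _xor_; if_then_else_; T)
open import Data.Bool.Properties using (T-∧; T-≡; T-not-≡; ∧-comm; ∧-assoc; not-involutive)
open import Data.Bool.ListAction using (all; any)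
open import Data.Product using (_×_; _,_; proj₁; proj₂)
open import Data.Unit using (tt)
open import Data.Empty using (⊥-elim)
open import Data.List using (List; []; _∷_; _++_; map; foldr; concatMap; upTo; applyUpTo; tabulate; allFin)
open import Data.List.Properties using (map-++; map-∘; map-cong)
open import Function using (_∘_; id; _⇔_; mk⇔; Equivalence)
open Equivalence using (to; from)
open import Relation.Binary.PropositionalEquality
open import Algebra.Properties.CommutativeSemigroup +-commutativeSemigroup using (x∙yz≈y∙xz; interchange)
open import Algebra.Properties.Monoid.Sum +-0-monoid using ()
  renaming (sum to ∑; sum-cong-≗ to ∑-cong)
open import Algebra.Properties.Monoid.Sum *-1-monoid using ()
  renaming (sum to ∏; sum-cong-≗ to ∏-cong; sum-replicate-zero to ∏-ones)

open ≡-Reasoning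

𝟙 : Bool → ℕ
𝟙 b = if b then 1 else 0

bools : List Bool
bools = true ∷ false ∷ []

ΣL : {A : Set} → List A → (A → ℕ) → ℕ
ΣL xs g = sum (map g xs)

countᵇ-ΣL : {A : Set} (p : A → Bool) (xs : List A) → countᵇ p xs ≡ ΣL xs (𝟙 ∘ p)
countᵇ-ΣL p []       = refl
countᵇ-ΣL p (x ∷ xs) = cong (𝟙 (p x) +_) (countᵇ-ΣL p xs)

ΣL-cong : {A : Set} (xs : List A) {g h : A → ℕ} → (∀ x → g x ≡ h x) → ΣL xs g ≡ ΣL xs h
ΣL-cong []       e = refl
ΣL-cong (x ∷ xs) e = cong₂ _+_ (e x) (ΣL-cong xs e)

ΣL-map : {A B : Set} (f : A → B) (xs : List A) (g : B → ℕ) → ΣL (map f xs) g ≡ ΣL xs (g ∘ f)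
ΣL-map f xs g = cong sum (sym (map-∘ xs))

ΣL-concatMap : {A B : Set} (f : A → List B) (xs : List A) (g : B → ℕ) →
               ΣL (concatMap f xs) g ≡ ΣL xs (λ x → ΣL (f x) g)
ΣL-concatMap f []       g = refl
ΣL-concatMap f (x ∷ xs) g = begin
  sum (map g (f x ++ concatMap f xs))         ≡⟨ cong sum (map-++ g (f x) _) ⟩
  sum (map g (f x) ++ map g (concatMap f xs)) ≡⟨ sum-++ (map g (f x)) _ ⟩
  ΣL (f x) g + ΣL (concatMap f xs) g          ≡⟨ cong (ΣL (f x) g +_) (ΣL-concatMap f xs g) ⟩
  ΣL (f x) g + ΣL xs (λ y → ΣL (f y) g)       ∎

ΣL-*ˡ : {A : Set} (c : ℕ) (xs : List A) (g : A → ℕ) → c * ΣL xs g ≡ ΣL xs (λ x → c * g x)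
ΣL-*ˡ c []       g = *-zeroʳ c
ΣL-*ˡ c (x ∷ xs) g = trans (*-distribˡ-+ c (g x) _) (cong (c * g x +_) (ΣL-*ˡ c xs g))

ΣL-*ʳ : {A : Set} (c : ℕ) (xs : List A) (g : A → ℕ) → ΣL xs g * c ≡ ΣL xs (λ x → g x * c)
ΣL-*ʳ c []       g = refl
ΣL-*ʳ c (x ∷ xs) g = trans (*-distribʳ-+ c (g x) _) (cong (g x * c +_) (ΣL-*ʳ c xs g))

∏-pow2 : {m : ℕ} (f : Fin m → ℕ) → ∏ (λ i → 2 ^ f i) ≡ 2 ^ ∑ f
∏-pow2 {zero}  f = refl
∏-pow2 {suc m} f = trans (cong (2 ^ f zero *_) (∏-pow2 (f ∘ suc))) (sym (^-distribˡ-+-* 2 (f zero) _))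

ΣA : {X : Set} → List X → (m : ℕ) → ((Fin m → X) → ℕ) → ℕ
ΣA xs m g = ΣL (allFuns xs m) g

ΣA-cong : {X : Set} (xs : List X) (m : ℕ) {g h : (Fin m → X) → ℕ} →
          (∀ f → g f ≡ h f) → ΣA xs m g ≡ ΣA xs m h
ΣA-cong xs m = ΣL-cong (allFuns xs m)

ΣA-extend : {X : Set} (xs : List X) (m : ℕ) (g : (Fin (suc m) → X) → ℕ) →
            ΣA xs (suc m) g ≡ ΣL xs (λ x → ΣA xs m (g ∘ extend x))
ΣA-extend xs m g = trans (ΣL-concatMap _ xs g) (ΣL-cong xs (λ x → ΣL-map (extend x) (allFuns xs m) g))

-- Concatenation of functions on Fin m and Fin k, built with extend so that it
-- follows the recursion of allFuns.
append : {X : Set} {m k : ℕ} → (Fin m → X) → (Fin k → X) → Fin (m + k) → X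
append {m = zero}  α β = β
append {m = suc m} α β = extend (α zero) (append (α ∘ suc) β)

append-↑ˡ : {X : Set} {m k : ℕ} (α : Fin m → X) (β : Fin k → X) (i : Fin m) → append α β (i ↑ˡ k) ≡ α i
append-↑ˡ α β zero    = refl
append-↑ˡ α β (suc i) = append-↑ˡ (α ∘ suc) β i

append-↑ʳ : {X : Set} (m : ℕ) {k : ℕ} (α : Fin m → X) (β : Fin k → X) (j : Fin k) → append α β (m ↑ʳ j) ≡ β j
append-↑ʳ zero    α β j = refl
append-↑ʳ (suc m) α β j = append-↑ʳ m (α ∘ suc) β j

ΣA-append : {X : Set} (xs : List X) (m k : ℕ) (g : (Fin (m + k) → X) → ℕ) →
            ΣA xs (m + k) g ≡ ΣA xs m (λ α → ΣA xs k (λ β → g (append α β)))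
ΣA-append xs zero    k g = sym (+-identityʳ _)
ΣA-append xs (suc m) k g = begin
  ΣA xs (suc (m + k)) g
    ≡⟨ ΣA-extend xs (m + k) g ⟩
  ΣL xs (λ x → ΣA xs (m + k) (g ∘ extend x))
    ≡⟨ ΣL-cong xs (λ x → ΣA-append xs m k (g ∘ extend x)) ⟩
  ΣL xs (λ x → ΣA xs m (λ α → ΣA xs k (g ∘ extend x ∘ append α)))
    ≡⟨ ΣA-extend xs m _ ⟨
  ΣA xs (suc m) (λ α → ΣA xs k (λ β → g (append α β))) ∎

ΣA-∏ : {X : Set} (xs : List X) (m : ℕ) (h : Fin m → X → ℕ) →
       ΣA xs m (λ f → ∏ (λ i → h i (f i))) ≡ ∏ (λ i → ΣL xs (h i))
ΣA-∏ xs zero    h = refl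
ΣA-∏ xs (suc m) h = begin
  ΣA xs (suc m) (λ f → ∏ (λ i → h i (f i)))
    ≡⟨ ΣA-extend xs m _ ⟩
  ΣL xs (λ x → ΣA xs m (λ f → h zero x * ∏ (λ i → h (suc i) (f i))))
    ≡⟨ ΣL-cong xs (λ x → ΣL-*ˡ (h zero x) (allFuns xs m) _) ⟨
  ΣL xs (λ x → h zero x * ΣA xs m (λ f → ∏ (λ i → h (suc i) (f i))))
    ≡⟨ ΣL-cong xs (λ x → cong (h zero x *_) (ΣA-∏ xs m (h ∘ suc))) ⟩
  ΣL xs (λ x → h zero x * ∏ (λ i → ΣL xs (h (suc i))))
    ≡⟨ ΣL-*ʳ _ xs (h zero) ⟨
  ∏ (λ i → ΣL xs (h i)) ∎

-- A weight on functions Fin (1 + (m + k)) → X given through the value at zero and the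
-- two blocks; it must respect pointwise equality of the blocks (there is no funext).
BlockWeight : Set → ℕ → ℕ → Set
BlockWeight X m k = X → (Fin m → X) → (Fin k → X) → ℕ

Extensional : {X : Set} {m k : ℕ} → BlockWeight X m k → Set
Extensional {X} {m} {k} G = ∀ x {α α′ : Fin m → X} {β β′ : Fin k → X} →
  (∀ i → α i ≡ α′ i) → (∀ j → β j ≡ β′ j) → G x α β ≡ G x α′ β′

ΣA-blocks : {X : Set} (xs : List X) (m k : ℕ) (G : BlockWeight X m k) → Extensional G →
  ΣA xs (suc (m + k)) (λ f → G (f zero) (λ i → f (suc (i ↑ˡ k))) (λ j → f (suc (m ↑ʳ j))))
  ≡ ΣL xs (λ x → ΣA xs m (λ α → ΣA xs k (G x α)))
ΣA-blocks xs m k G G-ext =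
  trans (ΣA-extend xs (m + k) _)
        (ΣL-cong xs (λ x → trans (ΣA-append xs m k _)
          (ΣA-cong xs m (λ α → ΣA-cong xs k (λ β → G-ext x (append-↑ˡ α β) (append-↑ʳ m α β))))))

T-not-∨ : {x y : Bool} → T (not (x ∨ y)) ⇔ (T (not x) × T (not y))
T-not-∨ {false} {false} = mk⇔ (λ _ → tt , tt) (λ _ → tt)
T-not-∨ {false} {true}  = mk⇔ (λ ()) proj₂
T-not-∨ {true}          = mk⇔ (λ ()) proj₁

T-xor : {x y : Bool} → T (x xor y) ⇔ (x ≡ not y)
T-xor {false} {false} = mk⇔ (λ ()) (λ ())
T-xor {false} {true}  = mk⇔ (λ _ → refl) (λ _ → tt)
T-xor {true}  {false} = mk⇔ (λ _ → refl) (λ _ → tt)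
T-xor {true}  {true}  = mk⇔ (λ ()) (λ ())

T-ext : {x y : Bool} → (T x → T y) → (T y → T x) → x ≡ y
T-ext {false} {false} _ _ = refl
T-ext {false} {true}  _ g = ⊥-elim (g tt)
T-ext {true}  {false} f _ = ⊥-elim (f tt)
T-ext {true}  {true}  _ _ = refl

T-forallV : {m : ℕ} (p : Fin m → Bool) → T (forallV p) ⇔ (∀ i → T (p i))
T-forallV p = mk⇔ (elim p id) (intro p id)
  where
  elim : {X : Set} {m : ℕ} (p : X → Bool) (f : Fin m → X) → T (all p (tabulate f)) → ∀ i → T (p (f i))
  elim p f t zero    = proj₁ (to T-∧ t)
  elim p f t (suc i) = elim p (f ∘ suc) (proj₂ (to (T-∧ {p (f zero)}) t)) i
  intro : {X : Set} {m : ℕ} (p : X → Bool) (f : Fin m → X) → (∀ i → T (p (f i))) → T (all p (tabulate f))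
  intro {m = zero}  p f _ = tt
  intro {m = suc m} p f h = from T-∧ (h zero , intro p (f ∘ suc) (h ∘ suc))

T-not-existsV : {m : ℕ} (p : Fin m → Bool) → T (not (existsV p)) ⇔ (∀ i → T (not (p i)))
T-not-existsV p = mk⇔ (elim p id) (intro p id)
  where
  elim : {X : Set} {m : ℕ} (p : X → Bool) (f : Fin m → X) → T (not (any p (tabulate f))) → ∀ i → T (not (p (f i)))
  elim p f t zero    = proj₁ (to T-not-∨ t)
  elim p f t (suc i) = elim p (f ∘ suc) (proj₂ (to (T-not-∨ {p (f zero)}) t)) i
  intro : {X : Set} {m : ℕ} (p : X → Bool) (f : Fin m → X) → (∀ i → T (not (p (f i)))) → T (not (any p (tabulate f)))
  intro {m = zero}  p f _ = tt
  intro {m = suc m} p f h = from T-not-∨ (h zero , intro p (f ∘ suc) (h ∘ suc))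

forallV-cong : {m : ℕ} {p q : Fin m → Bool} → (∀ i → p i ≡ q i) → forallV p ≡ forallV q
forallV-cong {m} e = cong (foldr _∧_ true) (map-cong e (allFin m))

𝟙-∧ : (x y : Bool) → 𝟙 (x ∧ y) ≡ 𝟙 x * 𝟙 y
𝟙-∧ false y = refl
𝟙-∧ true  y = sym (+-identityʳ (𝟙 y))

𝟙-forallV : {m : ℕ} (p : Fin m → Bool) → 𝟙 (forallV p) ≡ ∏ (𝟙 ∘ p)
𝟙-forallV p = go p id
  where
  go : {X : Set} {m : ℕ} (p : X → Bool) (f : Fin m → X) → 𝟙 (all p (tabulate f)) ≡ ∏ (𝟙 ∘ p ∘ f)
  go {m = zero}  p f = refl
  go {m = suc m} p f = trans (𝟙-∧ (p (f zero)) _) (cong (𝟙 (p (f zero)) *_) (go p (f ∘ suc)))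

cellwise : {X : Set} {m k : ℕ} → (X → Bool) → (Fin m → X → Bool) → (Fin k → X → Bool) →
           (Fin (suc (m + k)) → X) → Bool
cellwise {m = m} {k} c₀ cL cR f =
  c₀ (f zero) ∧ (forallV (λ i → cL i (f (suc (i ↑ˡ k)))) ∧ forallV (λ j → cR j (f (suc (m ↑ʳ j)))))

T-cellwise : {X : Set} {m k : ℕ} (c₀ : X → Bool) (cL : Fin m → X → Bool) (cR : Fin k → X → Bool)
  (f : Fin (suc (m + k)) → X) →
  T (cellwise c₀ cL cR f) ⇔
  (T (c₀ (f zero)) × (∀ i → T (cL i (f (suc (i ↑ˡ k))))) × (∀ j → T (cR j (f (suc (m ↑ʳ j))))))
T-cellwise c₀ cL cR f = mk⇔
  (λ t → let (t₀ , tLR) = to T-∧ t ; (tL , tR) = to T-∧ tLR in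
         t₀ , to (T-forallV _) tL , to (T-forallV _) tR)
  (λ (t₀ , tL , tR) → from T-∧ (t₀ , from T-∧ (from (T-forallV _) tL , from (T-forallV _) tR)))

choices : {X : Set} → List X → (X → Bool) → ℕ
choices xs c = ΣL xs (𝟙 ∘ c)

ΣA-product : {X : Set} (xs : List X) (m k : ℕ) (P : (Fin m → X) → ℕ) (Q : (Fin k → X) → ℕ) →
  ΣA xs m (λ α → ΣA xs k (λ β → P α * Q β)) ≡ ΣA xs m P * ΣA xs k Q
ΣA-product xs m k P Q = begin
  ΣA xs m (λ α → ΣA xs k (λ β → P α * Q β)) ≡⟨ ΣA-cong xs m (λ α → ΣL-*ˡ (P α) (allFuns xs k) Q) ⟨
  ΣA xs m (λ α → P α * ΣA xs k Q)           ≡⟨ ΣL-*ʳ (ΣA xs k Q) (allFuns xs m) P ⟨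
  ΣA xs m P * ΣA xs k Q                     ∎

ΣA-cellwise : {X : Set} (xs : List X) (m k : ℕ)
  (c₀ : X → Bool) (cL : Fin m → X → Bool) (cR : Fin k → X → Bool) →
  ΣA xs (suc (m + k)) (𝟙 ∘ cellwise c₀ cL cR)
  ≡ choices xs c₀ * (∏ (λ i → choices xs (cL i)) * ∏ (λ j → choices xs (cR j)))
ΣA-cellwise xs m k c₀ cL cR = begin
  ΣA xs (suc (m + k)) (𝟙 ∘ cellwise c₀ cL cR)
    ≡⟨ ΣA-blocks xs m k G G-ext ⟩
  ΣL xs (λ x → ΣA xs m (λ α → ΣA xs k (G x α)))
    ≡⟨ ΣL-cong xs (λ x → ΣA-cong xs m (λ α → ΣA-cong xs k (λ β → factorise x α β))) ⟩
  ΣL xs (λ x → ΣA xs m (λ α → ΣA xs k (λ β → 𝟙 (c₀ x) * (PL α * PR β))))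
    ≡⟨ ΣL-cong xs (λ x → trans (ΣL-*ˡ (𝟙 (c₀ x)) (allFuns xs m) _)
                               (ΣA-cong xs m (λ α → ΣL-*ˡ (𝟙 (c₀ x)) (allFuns xs k) _))) ⟨
  ΣL xs (λ x → 𝟙 (c₀ x) * ΣA xs m (λ α → ΣA xs k (λ β → PL α * PR β)))
    ≡⟨ ΣL-cong xs (λ x → cong (𝟙 (c₀ x) *_) (ΣA-product xs m k PL PR)) ⟩
  ΣL xs (λ x → 𝟙 (c₀ x) * (ΣA xs m PL * ΣA xs k PR))
    ≡⟨ ΣL-*ʳ _ xs (𝟙 ∘ c₀) ⟨
  choices xs c₀ * (ΣA xs m PL * ΣA xs k PR)
    ≡⟨ cong (choices xs c₀ *_) (cong₂ _*_ (ΣA-∏ xs m (λ i → 𝟙 ∘ cL i)) (ΣA-∏ xs k (λ j → 𝟙 ∘ cR j))) ⟩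
  choices xs c₀ * (∏ (λ i → choices xs (cL i)) * ∏ (λ j → choices xs (cR j))) ∎
  where
  G : BlockWeight _ m k
  G x α β = 𝟙 (c₀ x ∧ (forallV (λ i → cL i (α i)) ∧ forallV (λ j → cR j (β j))))
  G-ext : Extensional G
  G-ext x eα eβ = cong (λ b → 𝟙 (c₀ x ∧ b))
    (cong₂ _∧_ (forallV-cong (λ i → cong (cL i) (eα i))) (forallV-cong (λ j → cong (cR j) (eβ j))))
  PL : (Fin m → _) → ℕ
  PL α = ∏ (λ i → 𝟙 (cL i (α i)))
  PR : (Fin k → _) → ℕ
  PR β = ∏ (λ j → 𝟙 (cR j (β j)))
  factorise : ∀ x α β → G x α β ≡ 𝟙 (c₀ x) * (PL α * PR β)
  factorise x α β = trans (𝟙-∧ (c₀ x) _) (cong (𝟙 (c₀ x) *_)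
    (trans (𝟙-∧ (forallV (λ i → cL i (α i))) _)
           (cong₂ _*_ (𝟙-forallV (λ i → cL i (α i))) (𝟙-forallV (λ j → cR j (β j))))))

orientedPair : Bool → Bool → Bool → Bool
orientedPair e x y = (x ⇒ᵇ e) ∧ (e ⇒ᵇ (x xor y))

IsOrientation : (G : Graph) → Rel (Graph.n G) → Set
IsOrientation G o = ∀ u v → T (orientedPair (Graph.adj G u v) (o u v) (o v u))

NotCyclic : {n : ℕ} → Rel n → Fin n → Fin n → Fin n → Set
NotCyclic o u v w = T (not (o u v ∧ o v w ∧ o w u))

NoCyclicTriangle : {n : ℕ} → Rel n → Set
NoCyclicTriangle o = ∀ u v w → NotCyclic o u v w

acyclicOrientationᵇ : (G : Graph) → Rel (Graph.n G) → Bool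
acyclicOrientationᵇ G o = isOrientation G o ∧ not (hasCyclicTriangle o)

T-acyclicOrientation : (G : Graph) (o : Rel (Graph.n G)) →
  T (acyclicOrientationᵇ G o) ⇔ (IsOrientation G o × NoCyclicTriangle o)
T-acyclicOrientation G o = mk⇔
  (λ t → let (or , nc) = to T-∧ t in
    (λ u v → to (T-forallV _) (to (T-forallV _) or u) v) ,
    (λ u v w → to (T-not-existsV _)
                 (to (T-not-existsV _) (to (T-not-existsV _) nc u) v) w))
  (λ (or , nc) → from T-∧
    ( from (T-forallV _) (λ u → from (T-forallV _) (or u))
    , from (T-not-existsV _) (λ u → from (T-not-existsV _) (λ v →
        from (T-not-existsV _) (nc u v)))))

orientedPair-nonEdge : {x y : Bool} → T (orientedPair false x y) ⇔ (x ≡ false)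
orientedPair-nonEdge {false} = mk⇔ (λ _ → refl) (λ _ → tt)
orientedPair-nonEdge {true}  = mk⇔ (λ ()) (λ ())

orientedPair-edge : {x y : Bool} → T (orientedPair true x y) ⇔ (y ≡ not x)
orientedPair-edge {false} {false} = mk⇔ (λ ()) (λ ())
orientedPair-edge {false} {true}  = mk⇔ (λ _ → refl) (λ _ → tt)
orientedPair-edge {true}  {false} = mk⇔ (λ _ → refl) (λ _ → tt)
orientedPair-edge {true}  {true}  = mk⇔ (λ ()) (λ ())

rotate : {n : ℕ} (o : Rel n) {u v w : Fin n} → NotCyclic o v w u → NotCyclic o u v w
rotate o {u} {v} {w} = subst (T ∘ not) (sym (trans (∧-comm (o u v) _) (∧-assoc (o v w) (o w u) (o u v))))

missing-arc : {n : ℕ} (o : Rel n) {u v w : Fin n} → o u v ≡ false → NotCyclic o u v w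
missing-arc o e rewrite e = tt

Σ< : ℕ → (ℕ → ℕ) → ℕ
Σ< zero    f = 0
Σ< (suc n) f = f 0 + Σ< n (f ∘ suc)

ΣL-upTo : (n : ℕ) (f : ℕ → ℕ) → ΣL (upTo n) f ≡ Σ< n f
ΣL-upTo n f = go id n
  where
  go : (g : ℕ → ℕ) (n : ℕ) → ΣL (applyUpTo g n) f ≡ Σ< n (f ∘ g)
  go g zero    = refl
  go g (suc n) = cong (f (g 0) +_) (go (g ∘ suc) n)

Σ<-cong : (n : ℕ) {f g : ℕ → ℕ} → (∀ i → i < n → f i ≡ g i) → Σ< n f ≡ Σ< n g
Σ<-cong zero    e = refl
Σ<-cong (suc n) e = cong₂ _+_ (e 0 (s≤s z≤n)) (Σ<-cong n (λ i i<n → e (suc i) (s≤s i<n)))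

Σ<-last : (n : ℕ) (f : ℕ → ℕ) → Σ< (suc n) f ≡ Σ< n f + f n
Σ<-last zero    f = +-comm (f 0) 0
Σ<-last (suc n) f = trans (cong (f 0 +_) (Σ<-last n (f ∘ suc))) (sym (+-assoc (f 0) _ _))

Σ<-+ : (n : ℕ) (f g : ℕ → ℕ) → Σ< n (λ i → f i + g i) ≡ Σ< n f + Σ< n g
Σ<-+ zero    f g = refl
Σ<-+ (suc n) f g = trans (cong (f 0 + g 0 +_) (Σ<-+ n (f ∘ suc) (g ∘ suc))) (interchange (f 0) (g 0) _ _)

Σ<-*ˡ : (n c : ℕ) (f : ℕ → ℕ) → c * Σ< n f ≡ Σ< n (λ i → c * f i)
Σ<-*ˡ zero    c f = *-zeroʳ c
Σ<-*ˡ (suc n) c f = trans (*-distribˡ-+ c (f 0) _) (cong (c * f 0 +_) (Σ<-*ˡ n c (f ∘ suc)))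

binomialSum : ℕ → (ℕ → ℕ → ℕ) → ℕ
binomialSum m h = Σ< (suc m) (λ i → (m C i) * h i (m ∸ i))

-- Pascal's rule, in the form: an element is either counted in the first or in the second argument.
binomialSum-suc : (m : ℕ) (h : ℕ → ℕ → ℕ) →
  binomialSum (suc m) h ≡ binomialSum m (λ i j → h (suc i) j) + binomialSum m (λ i j → h i (suc j))
binomialSum-suc m h = begin
  binomialSum (suc m) h ≡⟨⟩
  h₀ + Σ< (suc m) (λ i → (suc m C suc i) * h (suc i) (m ∸ i))
    ≡⟨ cong (h₀ +_) (Σ<-cong (suc m) (λ i _ → pascal i)) ⟩
  h₀ + Σ< (suc m) (λ i → (m C i) * h (suc i) (m ∸ i) + (m C suc i) * h (suc i) (m ∸ i))
    ≡⟨ cong (h₀ +_) (Σ<-+ (suc m) (λ i → (m C i) * h (suc i) (m ∸ i)) shifted) ⟩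
  h₀ + (binomialSum m (λ i j → h (suc i) j) + Σ< (suc m) shifted)
    ≡⟨ x∙yz≈y∙xz h₀ (binomialSum m (λ i j → h (suc i) j)) (Σ< (suc m) shifted) ⟩
  binomialSum m (λ i j → h (suc i) j) + (h₀ + Σ< (suc m) shifted)
    ≡⟨ cong (λ s → binomialSum m (λ i j → h (suc i) j) + (h₀ + s)) drop-last ⟩
  binomialSum m (λ i j → h (suc i) j) + binomialSum m (λ i j → h i (suc j)) ∎
  where
  h₀ : ℕ
  h₀ = h 0 (suc m) + 0
  shifted : ℕ → ℕ
  shifted i = (m C suc i) * h (suc i) (m ∸ i)
  pascal : ∀ i → (suc m C suc i) * h (suc i) (m ∸ i) ≡ (m C i) * h (suc i) (m ∸ i) + shifted i
  pascal i = trans (cong (_* h (suc i) (m ∸ i)) (sym (nCk+nC[k+1]≡[n+1]C[k+1] m i)))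
                   (*-distribʳ-+ (h (suc i) (m ∸ i)) (m C i) (m C suc i))
  -- the last term has C(m, m+1) = 0, and m ∸ i = 1 + (m ∸ (1 + i)) below m
  drop-last : Σ< (suc m) shifted ≡ Σ< m (λ i → (m C suc i) * h (suc i) (suc (m ∸ suc i)))
  drop-last = begin
    Σ< (suc m) shifted          ≡⟨ Σ<-last m shifted ⟩
    Σ< m shifted + shifted m    ≡⟨ cong (λ c → Σ< m shifted + c * h (suc m) (m ∸ m)) (k>n⇒nCk≡0 (n<1+n m)) ⟩
    Σ< m shifted + 0            ≡⟨ +-identityʳ _ ⟩
    Σ< m shifted                ≡⟨ Σ<-cong m (λ i i<m → cong (λ d → (m C suc i) * h (suc i) d) (+-∸-assoc 1 i<m)) ⟩
    Σ< m (λ i → (m C suc i) * h (suc i) (suc (m ∸ suc i))) ∎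

#true : {m : ℕ} → (Fin m → Bool) → ℕ
#true s = ∑ (𝟙 ∘ s)

#false : {m : ℕ} → (Fin m → Bool) → ℕ
#false s = ∑ (𝟙 ∘ not ∘ s)

ΣA-by-#true : (m : ℕ) (h : ℕ → ℕ → ℕ) → ΣA bools m (λ s → h (#true s) (#false s)) ≡ binomialSum m h
ΣA-by-#true zero    h = sym (+-identityʳ _)
ΣA-by-#true (suc m) h = begin
  ΣA bools (suc m) (λ s → h (#true s) (#false s))
    ≡⟨ ΣA-extend bools m _ ⟩
  ΣA bools m (λ s → h (suc (#true s)) (#false s)) + (ΣA bools m (λ s → h (#true s) (suc (#false s))) + 0)
    ≡⟨ cong₂ (λ a b → a + (b + 0)) (ΣA-by-#true m (λ i j → h (suc i) j)) (ΣA-by-#true m (λ i j → h i (suc j))) ⟩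
  binomialSum m (λ i j → h (suc i) j) + (binomialSum m (λ i j → h i (suc j)) + 0)
    ≡⟨ cong (binomialSum m (λ i j → h (suc i) j) +_) (+-identityʳ _) ⟩
  binomialSum m (λ i j → h (suc i) j) + binomialSum m (λ i j → h i (suc j))
    ≡⟨ binomialSum-suc m h ⟨
  binomialSum (suc m) h ∎

ΣA-by-#false : (m : ℕ) (h : ℕ → ℕ → ℕ) → ΣA bools m (λ s → h (#false s) (#true s)) ≡ binomialSum m h
ΣA-by-#false zero    h = sym (+-identityʳ _)
ΣA-by-#false (suc m) h = begin
  ΣA bools (suc m) (λ s → h (#false s) (#true s))
    ≡⟨ ΣA-extend bools m _ ⟩
  ΣA bools m (λ s → h (#false s) (suc (#true s))) + (ΣA bools m (λ s → h (suc (#false s)) (#true s)) + 0)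
    ≡⟨ cong₂ (λ a b → a + (b + 0)) (ΣA-by-#false m (λ i j → h i (suc j))) (ΣA-by-#false m (λ i j → h (suc i) j)) ⟩
  binomialSum m (λ i j → h i (suc j)) + (binomialSum m (λ i j → h (suc i) j) + 0)
    ≡⟨ cong (binomialSum m (λ i j → h i (suc j)) +_) (+-identityʳ _) ⟩
  binomialSum m (λ i j → h i (suc j)) + binomialSum m (λ i j → h (suc i) j)
    ≡⟨ +-comm (binomialSum m (λ i j → h i (suc j))) _ ⟩
  binomialSum m (λ i j → h (suc i) j) + binomialSum m (λ i j → h i (suc j))
    ≡⟨ binomialSum-suc m h ⟨
  binomialSum (suc m) h ∎

-- Whether two Booleans agree; defined by cases so that counting agreements is #true / #false.
agree : Bool → Bool → Bool
agree true  y = y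
agree false y = not y

∑-agree : {m : ℕ} (x : Bool) (s : Fin m → Bool) → ∑ (λ b → 𝟙 (agree x (s b))) ≡ (if x then #true s else #false s)
∑-agree true  s = refl
∑-agree false s = refl

∑-if : {m : ℕ} (s : Fin m → Bool) (t f : ℕ) → ∑ (λ a → if s a then t else f) ≡ #true s * t + #false s * f
∑-if {zero}  s t f = refl
∑-if {suc m} s t f with s zero
... | true  = trans (cong (t +_) (∑-if (s ∘ suc) t f)) (sym (+-assoc t _ _))
... | false = trans (cong (f +_) (∑-if (s ∘ suc) t f)) (x∙yz≈y∙xz f (#true (s ∘ suc) * t) (#false (s ∘ suc) * f))

agreementWeight : {m : ℕ} → (Fin m → Bool) → (Fin m → Bool) → ℕ
agreementWeight sA sB = ∏ (λ a → ∏ (λ b → 2 ^ 𝟙 (agree (sA a) (sB b))))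

agreementWeight-closed : {m : ℕ} (sA sB : Fin m → Bool) →
  agreementWeight sA sB ≡ 2 ^ (#true sA * #true sB + #false sA * #false sB)
agreementWeight-closed sA sB = begin
  ∏ (λ a → ∏ (λ b → 2 ^ 𝟙 (agree (sA a) (sB b))))
    ≡⟨ ∏-cong (λ a → ∏-pow2 (λ b → 𝟙 (agree (sA a) (sB b)))) ⟩
  ∏ (λ a → 2 ^ ∑ (λ b → 𝟙 (agree (sA a) (sB b))))
    ≡⟨ ∏-pow2 (λ a → ∑ (λ b → 𝟙 (agree (sA a) (sB b)))) ⟩
  2 ^ ∑ (λ a → ∑ (λ b → 𝟙 (agree (sA a) (sB b))))
    ≡⟨ cong (2 ^_) (∑-cong (λ a → ∑-agree (sA a) sB)) ⟩
  2 ^ ∑ (λ a → if sA a then #true sB else #false sB)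
    ≡⟨ cong (2 ^_) (∑-if sA (#true sB) (#false sB)) ⟩
  2 ^ (#true sA * #true sB + #false sA * #false sB) ∎

-- Summing the agreement weights over all pairs gives the right-hand side of the theorem:
-- i counts the true coordinates of sA and j the false coordinates of sB.
ΣA-agreementWeight : (ℓ : ℕ) →
  ΣA bools ℓ (λ sA → ΣA bools ℓ (λ sB → 2 ^ (#true sA * #true sB + #false sA * #false sB))) ≡ rhs ℓ
ΣA-agreementWeight ℓ = begin
  ΣA bools ℓ (λ sA → ΣA bools ℓ (λ sB → 2 ^ (#true sA * #true sB + #false sA * #false sB)))
    ≡⟨ ΣA-cong bools ℓ (λ sA → ΣA-by-#false ℓ (λ j j′ → 2 ^ (#true sA * j′ + #false sA * j))) ⟩
  ΣA bools ℓ (λ sA → inner (#true sA) (#false sA))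
    ≡⟨ ΣA-by-#true ℓ inner ⟩
  Σ< (suc ℓ) (λ i → (ℓ C i) * inner i (ℓ ∸ i))
    ≡⟨ Σ<-cong (suc ℓ) (λ i _ → trans (Σ<-*ˡ (suc ℓ) (ℓ C i) (λ j → (ℓ C j) * 2 ^ (i * (ℓ ∸ j) + (ℓ ∸ i) * j)))
                                        (Σ<-cong (suc ℓ) (λ j _ → term i j))) ⟩
  Σ< (suc ℓ) (λ i → Σ< (suc ℓ) (summand i))
    ≡⟨ Σ<-cong (suc ℓ) (λ i _ → ΣL-upTo (suc ℓ) (summand i)) ⟨
  Σ< (suc ℓ) (λ i → ΣL (upTo (suc ℓ)) (summand i))
    ≡⟨ ΣL-upTo (suc ℓ) _ ⟨
  rhs ℓ ∎
  where
  inner : ℕ → ℕ → ℕ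
  inner t f = Σ< (suc ℓ) (λ j → (ℓ C j) * 2 ^ (t * (ℓ ∸ j) + f * j))
  summand : ℕ → ℕ → ℕ
  summand i j = (ℓ C i) * (ℓ C j) * 2 ^ ((ℓ ∸ i) * j + (ℓ ∸ j) * i)
  term : ∀ i j → (ℓ C i) * ((ℓ C j) * 2 ^ (i * (ℓ ∸ j) + (ℓ ∸ i) * j)) ≡ summand i j
  term i j = trans (sym (*-assoc (ℓ C i) (ℓ C j) _))
    (cong (λ e → (ℓ C i) * (ℓ C j) * 2 ^ e) (trans (+-comm (i * (ℓ ∸ j)) _) (cong ((ℓ ∸ i) * j +_) (*-comm i (ℓ ∸ j)))))

-- With hub→a = sa, hub→b = sb, a→b = x and the reversed arcs on the way back,
-- the two candidate cyclic triangles through a hub are hub→a→b→hub and hub→b→a→hub.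
acyclicHubTriangle : Bool → Bool → Bool → Bool
acyclicHubTriangle sa sb x = not (sa ∧ x ∧ not sb) ∧ not (sb ∧ not x ∧ not sa)

choices-xor : (c : Bool) → choices bools (_xor c) ≡ 1
choices-xor false = refl
choices-xor true  = refl

choices-acyclicHubTriangle : (sa sb : Bool) → choices bools (acyclicHubTriangle sa sb) ≡ 2 ^ 𝟙 (agree sa sb)
choices-acyclicHubTriangle false false = refl
choices-acyclicHubTriangle false true  = refl
choices-acyclicHubTriangle true  false = refl
choices-acyclicHubTriangle true  true  = refl

not-swap : {x y : Bool} → y ≡ not x → x ≡ not y
not-swap {x} e = trans (sym (not-involutive x)) (cong not (sym e))

m+n≮ᵇm : (m n : ℕ) → ((m + n) <ᵇ m) ≡ false
m+n≮ᵇm zero    n = refl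
m+n≮ᵇm (suc m) n = m+n≮ᵇm m n

data Block (m k : ℕ) : Fin (m + k) → Set where
  left  : (i : Fin m) → Block m k (i ↑ˡ k)
  right : (j : Fin k) → Block m k (m ↑ʳ j)

block : (m k : ℕ) (i : Fin (m + k)) → Block m k i
block zero    k i       = right i
block (suc m) k zero    = left zero
block (suc m) k (suc i) with block m k i
... | left i′ = left (suc i′)
... | right j = right j

module K₁ℓℓ (ℓ : ℕ) where

  N : ℕ
  N = suc (ℓ + ℓ)

  hub : Fin N
  hub = zero

  vA : Fin ℓ → Fin N
  vA a = suc (a ↑ˡ ℓ)

  vB : Fin ℓ → Fin N
  vB b = suc (ℓ ↑ʳ b)

  data Kind : Fin N → Set where
    hubᵏ : Kind hub
    inA  : (a : Fin ℓ) → Kind (vA a)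
    inB  : (b : Fin ℓ) → Kind (vB b)

  kind : (u : Fin N) → Kind u
  kind zero = hubᵏ
  kind (suc i) with block ℓ ℓ i
  ... | left a  = inA a
  ... | right b = inB b

  part-A : (a : Fin ℓ) → part ℓ (vA a) ≡ 1
  part-A a = cong (λ t → if t then 1 else 2) (trans (cong (_<ᵇ ℓ) (toℕ-↑ˡ a ℓ)) (to T-≡ (<⇒<ᵇ (toℕ<n a))))

  part-B : (b : Fin ℓ) → part ℓ (vB b) ≡ 2
  part-B b = cong (λ t → if t then 1 else 2) (trans (cong (_<ᵇ ℓ) (toℕ-↑ʳ ℓ b)) (m+n≮ᵇm ℓ (toℕ b)))

  adj : Fin N → Fin N → Bool
  adj = Graph.adj (K1ℓℓ ℓ)

  adjacent : (u v : Fin N) {p q : ℕ} → part ℓ u ≡ p → part ℓ v ≡ q → adj u v ≡ not (p ≡ᵇ q)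
  adjacent u v refl refl = refl

  arc-nonEdge : (o : Rel N) {u v : Fin N} → adj u v ≡ false →
                T (orientedPair (adj u v) (o u v) (o v u)) ⇔ (o u v ≡ false)
  arc-nonEdge o {u} {v} e =
    subst (λ a → T (orientedPair a (o u v) (o v u)) ⇔ (o u v ≡ false)) (sym e) (orientedPair-nonEdge {y = o v u})

  arc-edge : (o : Rel N) {u v : Fin N} → adj u v ≡ true →
             T (orientedPair (adj u v) (o u v) (o v u)) ⇔ (o v u ≡ not (o u v))
  arc-edge o {u} {v} e =
    subst (λ a → T (orientedPair a (o u v) (o v u)) ⇔ (o v u ≡ not (o u v))) (sym e) orientedPair-edge

  record LocallyAcyclic (o : Rel N) : Set where
    field
      hub-loop : o hub hub ≡ false
      a-hub    : ∀ a → o (vA a) hub ≡ not (o hub (vA a))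
      a-a      : ∀ a a′ → o (vA a) (vA a′) ≡ false
      hub-a-b  : ∀ a b → T (acyclicHubTriangle (o hub (vA a)) (o hub (vB b)) (o (vA a) (vB b)))
      b-hub    : ∀ b → o (vB b) hub ≡ not (o hub (vB b))
      b-a      : ∀ b a → o (vB b) (vA a) ≡ not (o (vA a) (vB b))
      b-b      : ∀ b b′ → o (vB b) (vB b′) ≡ false

  -- The same description as a Boolean, organised row by row: given the hub row r₀, every
  -- row of A is a cellwise condition, and so is every row of B given the rows α of A.
  Row : Set
  Row = Fin N → Bool

  hubRowOK : Row → Bool
  hubRowOK r₀ = not (r₀ hub)

  aRowOK : Row → Fin ℓ → Row → Bool
  aRowOK r₀ a = cellwise (_xor r₀ (vA a)) (λ _ → not) (λ b → acyclicHubTriangle (r₀ (vA a)) (r₀ (vB b)))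

  bRowOK : Row → (Fin ℓ → Row) → Fin ℓ → Row → Bool
  bRowOK r₀ α b = cellwise (_xor r₀ (vB b)) (λ a → _xor α a (vB b)) (λ _ → not)

  bRowOK-cong : (r₀ : Row) {α α′ : Fin ℓ → Row} (b : Fin ℓ) {row row′ : Row} →
    (∀ a → α a ≡ α′ a) → row ≡ row′ → bRowOK r₀ α b row ≡ bRowOK r₀ α′ b row′
  bRowOK-cong r₀ {α} {α′} b {row} eα refl =
    cong (λ x → (row hub xor r₀ (vB b)) ∧ (x ∧ forallV (λ b′ → not (row (vB b′)))))
         (forallV-cong (λ a → cong (λ r → row (vA a) xor r (vB b)) (eα a)))

  localRows : Row → (Fin ℓ → Row) → (Fin ℓ → Row) → Bool
  localRows r₀ α β = hubRowOK r₀ ∧ (forallV (λ a → aRowOK r₀ a (α a)) ∧ forallV (λ b → bRowOK r₀ α b (β b)))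

  localᵇ : Rel N → Bool
  localᵇ o = localRows (o hub) (o ∘ vA) (o ∘ vB)

  localRows-cong : (r₀ : Row) {α α′ β β′ : Fin ℓ → Row} →
    (∀ a → α a ≡ α′ a) → (∀ b → β b ≡ β′ b) → localRows r₀ α β ≡ localRows r₀ α′ β′
  localRows-cong r₀ {α} {α′} {β} {β′} eα eβ = cong (hubRowOK r₀ ∧_) (cong₂ _∧_
    (forallV-cong (λ a → cong (aRowOK r₀ a) (eα a)))
    (forallV-cong (λ b → bRowOK-cong r₀ b eα (eβ b))))

  T-local : (o : Rel N) → T (localᵇ o) ⇔ LocallyAcyclic o
  T-local o = mk⇔
    (λ t → let (h , ta , tb) = to byRows t
               A = λ a → to (rowA a) (ta a)
               B = λ b → to (rowB b) (tb b) in
      record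
        { hub-loop = to T-not-≡ h
        ; a-hub    = λ a → to T-xor (proj₁ (A a))
        ; a-a      = λ a a′ → to T-not-≡ (proj₁ (proj₂ (A a)) a′)
        ; hub-a-b  = λ a → proj₂ (proj₂ (A a))
        ; b-hub    = λ b → to T-xor (proj₁ (B b))
        ; b-a      = λ b a → to T-xor (proj₁ (proj₂ (B b)) a)
        ; b-b      = λ b b′ → to T-not-≡ (proj₂ (proj₂ (B b)) b′)
        })
    (λ L → let open LocallyAcyclic L in
      from byRows
        ( from T-not-≡ hub-loop
        , (λ a → from (rowA a) (from T-xor (a-hub a) , (λ a′ → from T-not-≡ (a-a a a′)) , hub-a-b a))
        , (λ b → from (rowB b) (from T-xor (b-hub b) , (λ a → from T-xor (b-a b a)) , (λ b′ → from T-not-≡ (b-b b b′))))))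
    where
    byRows : T (localᵇ o) ⇔ (T (hubRowOK (o hub)) × (∀ a → T (aRowOK (o hub) a (o (vA a))))
                                               × (∀ b → T (bRowOK (o hub) (o ∘ vA) b (o (vB b)))))
    byRows = T-cellwise hubRowOK (aRowOK (o hub)) (bRowOK (o hub) (o ∘ vA)) o
    rowA : (a : Fin ℓ) → T (aRowOK (o hub) a (o (vA a))) ⇔
      (T (o (vA a) hub xor o hub (vA a)) × (∀ a′ → T (not (o (vA a) (vA a′))))
                                          × (∀ b → T (acyclicHubTriangle (o hub (vA a)) (o hub (vB b)) (o (vA a) (vB b)))))
    rowA a = T-cellwise (_xor o hub (vA a)) (λ _ → not)
                        (λ b → acyclicHubTriangle (o hub (vA a)) (o hub (vB b))) (o (vA a))
    rowB : (b : Fin ℓ) → T (bRowOK (o hub) (o ∘ vA) b (o (vB b))) ⇔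
      (T (o (vB b) hub xor o hub (vB b)) × (∀ a → T (o (vB b) (vA a) xor o (vA a) (vB b)))
                                          × (∀ b′ → T (not (o (vB b) (vB b′)))))
    rowB b = T-cellwise (_xor o hub (vB b)) (λ a → _xor o (vA a) (vB b)) (λ _ → not) (o (vB b))

  hubTriangles : (o : Rel N) (a b : Fin ℓ) →
    o (vB b) hub ≡ not (o hub (vB b)) → o (vB b) (vA a) ≡ not (o (vA a) (vB b)) →
    o (vA a) hub ≡ not (o hub (vA a)) →
    T (acyclicHubTriangle (o hub (vA a)) (o hub (vB b)) (o (vA a) (vB b)))
      ⇔ (NotCyclic o hub (vA a) (vB b) × NotCyclic o hub (vB b) (vA a))
  hubTriangles o a b e₁ e₂ e₃ rewrite e₁ | e₂ | e₃ = T-∧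

  module _ (o : Rel N) where

    acyclic⇒local : IsOrientation (K1ℓℓ ℓ) o → NoCyclicTriangle o → LocallyAcyclic o
    acyclic⇒local or nc = record
      { hub-loop = to (arc-nonEdge o (adjacent hub hub refl refl)) (or hub hub)
      ; a-hub    = a-hub
      ; a-a      = λ a a′ → to (arc-nonEdge o (adjacent (vA a) (vA a′) (part-A a) (part-A a′))) (or (vA a) (vA a′))
      ; hub-a-b  = λ a b → from (hubTriangles o a b (b-hub b) (b-a b a) (a-hub a)) (nc hub (vA a) (vB b) , nc hub (vB b) (vA a))
      ; b-hub    = b-hub
      ; b-a      = b-a
      ; b-b      = λ b b′ → to (arc-nonEdge o (adjacent (vB b) (vB b′) (part-B b) (part-B b′))) (or (vB b) (vB b′))
      }
      where
      a-hub : ∀ a → o (vA a) hub ≡ not (o hub (vA a))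
      a-hub a = to (arc-edge o (adjacent hub (vA a) refl (part-A a))) (or hub (vA a))
      b-hub : ∀ b → o (vB b) hub ≡ not (o hub (vB b))
      b-hub b = to (arc-edge o (adjacent hub (vB b) refl (part-B b))) (or hub (vB b))
      b-a : ∀ b a → o (vB b) (vA a) ≡ not (o (vA a) (vB b))
      b-a b a = to (arc-edge o (adjacent (vA a) (vB b) (part-A a) (part-B b))) (or (vA a) (vB b))

    module _ (L : LocallyAcyclic o) where
      open LocallyAcyclic L

      local⇒orientation : IsOrientation (K1ℓℓ ℓ) o
      local⇒orientation u v with kind u | kind v
      ... | hubᵏ  | hubᵏ  = from (arc-nonEdge o (adjacent hub hub refl refl)) hub-loop
      ... | hubᵏ  | inA a = from (arc-edge o (adjacent hub (vA a) refl (part-A a))) (a-hub a)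
      ... | hubᵏ  | inB b = from (arc-edge o (adjacent hub (vB b) refl (part-B b))) (b-hub b)
      ... | inA a | hubᵏ  = from (arc-edge o (adjacent (vA a) hub (part-A a) refl)) (not-swap (a-hub a))
      ... | inA a | inA a′ = from (arc-nonEdge o (adjacent (vA a) (vA a′) (part-A a) (part-A a′))) (a-a a a′)
      ... | inA a | inB b = from (arc-edge o (adjacent (vA a) (vB b) (part-A a) (part-B b))) (b-a b a)
      ... | inB b | hubᵏ  = from (arc-edge o (adjacent (vB b) hub (part-B b) refl)) (not-swap (b-hub b))
      ... | inB b | inA a = from (arc-edge o (adjacent (vB b) (vA a) (part-B b) (part-A a))) (not-swap (b-a b a))
      ... | inB b | inB b′ = from (arc-nonEdge o (adjacent (vB b) (vB b′) (part-B b) (part-B b′))) (b-b b b′)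

      -- Triangles starting at the hub: either an arc inside a part is used, or it is one
      -- of the two hub triangles.
      hubFirst : ∀ v w → NotCyclic o hub v w
      hubFirst v w with kind v | kind w
      ... | hubᵏ  | _      = missing-arc o hub-loop
      ... | _     | hubᵏ   = rotate o (rotate o (missing-arc o hub-loop))
      ... | inA a | inA a′ = rotate o (missing-arc o (a-a a a′))
      ... | inB b | inB b′ = rotate o (missing-arc o (b-b b b′))
      ... | inA a | inB b  = proj₁ (to (hubTriangles o a b (b-hub b) (b-a b a) (a-hub a)) (hub-a-b a b))
      ... | inB b | inA a  = proj₂ (to (hubTriangles o a b (b-hub b) (b-a b a) (a-hub a)) (hub-a-b a b))

      -- Any other triangle is rotated to start at the hub, or uses an arc inside a part.
      local⇒noCyclic : NoCyclicTriangle o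
      local⇒noCyclic u v w with kind u | kind v | kind w
      ... | hubᵏ  | _      | _      = hubFirst v w
      ... | _     | hubᵏ   | _      = rotate o (hubFirst w u)
      ... | _     | _      | hubᵏ   = rotate o (rotate o (hubFirst u v))
      ... | inA a | inA a′ | _      = missing-arc o (a-a a a′)
      ... | inB b | inB b′ | _      = missing-arc o (b-b b b′)
      ... | _     | inA a  | inA a′ = rotate o (missing-arc o (a-a a a′))
      ... | _     | inB b  | inB b′ = rotate o (missing-arc o (b-b b b′))
      ... | inA a | inB b  | inA a′ = rotate o (rotate o (missing-arc o (a-a a′ a)))
      ... | inB b | inA a  | inB b′ = rotate o (rotate o (missing-arc o (b-b b′ b)))

    acyclic≡local : acyclicOrientationᵇ (K1ℓℓ ℓ) o ≡ localᵇ o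
    acyclic≡local = T-ext
      (λ t → let (or , nc) = to (T-acyclicOrientation (K1ℓℓ ℓ) o) t in from (T-local o) (acyclic⇒local or nc))
      (λ t → let L = to (T-local o) t in
             from (T-acyclicOrientation (K1ℓℓ ℓ) o) (local⇒orientation L , local⇒noCyclic L))

  rows : List Row
  rows = allFuns bools N

  ΣA-aRow : (r₀ : Row) (a : Fin ℓ) →
    ΣA bools N (𝟙 ∘ aRowOK r₀ a) ≡ ∏ (λ b → 2 ^ 𝟙 (agree (r₀ (vA a)) (r₀ (vB b))))
  ΣA-aRow r₀ a = begin
    ΣA bools N (𝟙 ∘ aRowOK r₀ a)
      ≡⟨ ΣA-cellwise bools ℓ ℓ (_xor sa) (λ _ → not) (λ b → acyclicHubTriangle sa (r₀ (vB b))) ⟩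
    choices bools (_xor sa) * (∏ {ℓ} (λ _ → 1) * ∏ (λ b → choices bools (acyclicHubTriangle sa (r₀ (vB b)))))
      ≡⟨ cong₂ _*_ (choices-xor sa)
                   (cong₂ _*_ (∏-ones ℓ) (∏-cong (λ b → choices-acyclicHubTriangle sa (r₀ (vB b))))) ⟩
    1 * (1 * ∏ (λ b → 2 ^ 𝟙 (agree sa (r₀ (vB b)))))
      ≡⟨ trans (*-identityˡ _) (*-identityˡ _) ⟩
    ∏ (λ b → 2 ^ 𝟙 (agree sa (r₀ (vB b)))) ∎
    where
    sa : Bool
    sa = r₀ (vA a)

  ΣA-bRow : (r₀ : Row) (α : Fin ℓ → Row) (b : Fin ℓ) → ΣA bools N (𝟙 ∘ bRowOK r₀ α b) ≡ 1
  ΣA-bRow r₀ α b = begin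
    ΣA bools N (𝟙 ∘ bRowOK r₀ α b)
      ≡⟨ ΣA-cellwise bools ℓ ℓ (_xor r₀ (vB b)) (λ a → _xor α a (vB b)) (λ _ → not) ⟩
    choices bools (_xor r₀ (vB b)) * (∏ (λ a → choices bools (_xor α a (vB b))) * ∏ {ℓ} (λ _ → 1))
      ≡⟨ cong₂ _*_ (choices-xor (r₀ (vB b)))
                   (cong₂ _*_ (trans (∏-cong (λ a → choices-xor (α a (vB b)))) (∏-ones ℓ)) (∏-ones ℓ)) ⟩
    1 ∎

  ΣA-rowsAB : (r₀ : Row) →
    ΣA rows ℓ (λ α → ΣA rows ℓ (λ β → 𝟙 (localRows r₀ α β)))
    ≡ 𝟙 (hubRowOK r₀) * agreementWeight (r₀ ∘ vA) (r₀ ∘ vB)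
  ΣA-rowsAB r₀ = begin
    ΣA rows ℓ (λ α → ΣA rows ℓ (λ β → 𝟙 (localRows r₀ α β)))
      ≡⟨ ΣA-cong rows ℓ (λ α → ΣA-cong rows ℓ (factorise α)) ⟩
    ΣA rows ℓ (λ α → ΣA rows ℓ (λ β → h * (PA α * PB α β)))
      ≡⟨ pull-out ⟨
    h * ΣA rows ℓ (λ α → PA α * ΣA rows ℓ (PB α))
      ≡⟨ cong (h *_) (ΣA-cong rows ℓ (λ α → trans (cong (PA α *_) (b-rows α)) (*-identityʳ (PA α)))) ⟩
    h * ΣA rows ℓ PA
      ≡⟨ cong (h *_) a-rows ⟩
    h * agreementWeight (r₀ ∘ vA) (r₀ ∘ vB) ∎
    where
    h : ℕ
    h = 𝟙 (hubRowOK r₀)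
    PA : (Fin ℓ → Row) → ℕ
    PA α = ∏ (λ a → 𝟙 (aRowOK r₀ a (α a)))
    PB : (Fin ℓ → Row) → (Fin ℓ → Row) → ℕ
    PB α β = ∏ (λ b → 𝟙 (bRowOK r₀ α b (β b)))
    pull-out : h * ΣA rows ℓ (λ α → PA α * ΣA rows ℓ (PB α))
               ≡ ΣA rows ℓ (λ α → ΣA rows ℓ (λ β → h * (PA α * PB α β)))
    pull-out = trans (ΣL-*ˡ h (allFuns rows ℓ) _) (ΣA-cong rows ℓ (λ α →
      trans (cong (h *_) (ΣL-*ˡ (PA α) (allFuns rows ℓ) (PB α))) (ΣL-*ˡ h (allFuns rows ℓ) _)))
    b-rows : ∀ α → ΣA rows ℓ (PB α) ≡ 1
    b-rows α = trans (ΣA-∏ rows ℓ (λ b → 𝟙 ∘ bRowOK r₀ α b)) (trans (∏-cong (ΣA-bRow r₀ α)) (∏-ones ℓ))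
    a-rows : ΣA rows ℓ PA ≡ agreementWeight (r₀ ∘ vA) (r₀ ∘ vB)
    a-rows = trans (ΣA-∏ rows ℓ (λ a → 𝟙 ∘ aRowOK r₀ a)) (∏-cong (ΣA-aRow r₀))
    factorise : ∀ α β → 𝟙 (localRows r₀ α β) ≡ h * (PA α * PB α β)
    factorise α β = trans (𝟙-∧ (hubRowOK r₀) _) (cong (h *_) (trans (𝟙-∧ (forallV (λ a → aRowOK r₀ a (α a))) _)
      (cong₂ _*_ (𝟙-forallV (λ a → aRowOK r₀ a (α a))) (𝟙-forallV (λ b → bRowOK r₀ α b (β b))))))

  ΣA-local : ΣA rows N (𝟙 ∘ localᵇ) ≡ ΣA bools ℓ (λ sA → ΣA bools ℓ (agreementWeight sA))
  ΣA-local = begin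
    ΣA rows N (𝟙 ∘ localᵇ)
      ≡⟨ ΣA-blocks rows ℓ ℓ G G-ext ⟩
    ΣL rows (λ r₀ → ΣA rows ℓ (λ α → ΣA rows ℓ (G r₀ α)))
      ≡⟨ ΣL-cong rows ΣA-rowsAB ⟩
    ΣA bools N (λ r₀ → H (r₀ hub) (r₀ ∘ vA) (r₀ ∘ vB))
      ≡⟨ ΣA-blocks bools ℓ ℓ H H-ext ⟩
    ΣL bools (λ y → ΣA bools ℓ (λ sA → ΣA bools ℓ (λ sB → 𝟙 (not y) * agreementWeight sA sB)))
      ≡⟨ ΣL-cong bools (λ y → trans (ΣL-*ˡ (𝟙 (not y)) (allFuns bools ℓ) _)
                                    (ΣA-cong bools ℓ (λ sA → ΣL-*ˡ (𝟙 (not y)) (allFuns bools ℓ) (agreementWeight sA)))) ⟨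
    ΣL bools (λ y → 𝟙 (not y) * S)
      ≡⟨ trans (+-identityʳ _) (+-identityʳ S) ⟩
    S ∎
    where
    G : BlockWeight Row ℓ ℓ
    G r₀ α β = 𝟙 (localRows r₀ α β)
    G-ext : Extensional G
    G-ext r₀ eα eβ = cong 𝟙 (localRows-cong r₀ eα eβ)
    H : BlockWeight Bool ℓ ℓ
    H y sA sB = 𝟙 (not y) * agreementWeight sA sB
    H-ext : Extensional H
    H-ext y eA eB = cong (𝟙 (not y) *_) (∏-cong (λ a → ∏-cong (λ b → cong₂ (λ x z → 2 ^ 𝟙 (agree x z)) (eA a) (eB b))))
    S : ℕ
    S = ΣA bools ℓ (λ sA → ΣA bools ℓ (agreementWeight sA))

proposition3p1 : (ℓ : ℕ) → 1 ≤ ℓ → D-cyc (K1ℓℓ ℓ) ≡ rhs ℓ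
proposition3p1 ℓ _ = begin
  D-cyc (K1ℓℓ ℓ)
    ≡⟨ countᵇ-ΣL (acyclicOrientationᵇ (K1ℓℓ ℓ)) (allRels N) ⟩
  ΣA rows N (𝟙 ∘ acyclicOrientationᵇ (K1ℓℓ ℓ))
    ≡⟨ ΣA-cong rows N (cong 𝟙 ∘ acyclic≡local) ⟩
  ΣA rows N (𝟙 ∘ localᵇ)
    ≡⟨ ΣA-local ⟩
  ΣA bools ℓ (λ sA → ΣA bools ℓ (agreementWeight sA))
    ≡⟨ ΣA-cong bools ℓ (λ sA → ΣA-cong bools ℓ (agreementWeight-closed sA)) ⟩
  ΣA bools ℓ (λ sA → ΣA bools ℓ (λ sB → 2 ^ (#true sA * #true sB + #false sA * #false sB)))
    ≡⟨ ΣA-agreementWeight ℓ ⟩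
  rhs ℓ ∎
  where open K₁ℓℓ ℓ
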